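{- Let $k\geq 3$ and let $G=(V,E)$ be a finite simple graph with chromatic number $k+1$ and girth $g>2k$, whose vertices are labelled by $[n]$ so that every index-increasing path of $G$ has length at most $k$. Let $\boldsymbol{\alpha}\in\mathbb{Z}_k^V$ satisfy $|\boldsymbol{\alpha}|<\frac{g}{2k}-1$. Then the descendant graph of the monomial $x^{\boldsymbol{\alpha}}$ is a forest.
   Context: A path $u_1\cdots u_t$ is index-increasing if $u_1<\dots<u_t$; its length is its number of edges. For an edge $\{u,v\}$ with $u<v$, $u$ is a parent of $v$ and $v$ is a child of $u$; $v$ is a descendant of $u$ if there is an index-increasing path from $u$ to $v$. For $\boldsymbol{\alpha}\in\mathbb{Z}_k^V$ (entries identified with $\{0,\dots,k-1\}$), $|\boldsymbol{\alpha}|=\sum_w\boldsymbol{\alpha}_w$, $\supp(\boldsymbol{\alpha})=\{w:\boldsymbol{\alpha}_w>0\}$, and $x^{\boldsymbol{\alpha}}=\prod_w x_w^{\boldsymbol{\alpha}_w}$. The descendant graph of $x^{\boldsymbol{\alpha}}$ is the subgraph of $G$ induced by the vertices of $\supp(\boldsymbol{\alpha})$ together with all their descendants. -}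

module Defs where

open import Data.Nat using (ℕ; zero; suc; _+_; _*_; _≤_; _<_)
open import Data.Fin using (Fin; toℕ)
import Data.Fin as F
open import Data.Bool using (Bool; true)
open import Data.List using (List; []; _∷_; _++_; [_]; length; map; allFin)
open import Data.Nat.ListAction using (sum)
open import Data.Empty using (⊥)
open import Data.List.Membership.Propositional using (_∈_)
open import Data.List.Relation.Unary.Linked using (Linked)
open import Data.List.Relation.Unary.Unique.Propositional using (Unique)
open import Data.Product using (Σ; _×_; ∃)
open import Data.Sum using (_⊎_)
open import Relation.Nullary using (¬_)
open import Relation.Binary.PropositionalEquality using (_≡_; _≢_)

-- A finite simple graph on the vertex set [n], represented as Fin n
-- (the labelling of the vertices by [n] is the order on Fin n).
record SimpleGraph (n : ℕ) : Set where
  field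
    adj    : Fin n → Fin n → Bool
    sym    : ∀ u v → adj u v ≡ adj v u
    irrefl : ∀ u → ¬ (adj u u ≡ true)

module _ {n : ℕ} (G : SimpleGraph n) where
  open SimpleGraph G

  Adj : Fin n → Fin n → Set
  Adj u v = adj u v ≡ true

  Colorable : ℕ → Set
  Colorable m = Σ (Fin n → Fin m) λ c → ∀ u v → Adj u v → c u ≢ c v

  -- chromatic number equals m+1 (written with m+1 to avoid subtraction)
  ChromaticNumberSuc : ℕ → Set
  ChromaticNumberSuc m = Colorable (suc m) × ¬ Colorable m

  -- a cycle v ∷ vs : distinct vertices, at least 3 of them,
  -- consecutive ones adjacent and the last adjacent to the first.
  -- Its length (number of edges) is length (v ∷ vs).
  IsCycle : List (Fin n) → Set
  IsCycle [] = ⊥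
  IsCycle (v ∷ vs) = (3 ≤ length (v ∷ vs)) × Unique (v ∷ vs) × Linked Adj (v ∷ vs ++ [ v ])

  Girth : ℕ → Set
  Girth g = (Σ (List (Fin n)) λ c → IsCycle c × length c ≡ g)
          × (∀ c → IsCycle c → g ≤ length c)

  IncStep : Fin n → Fin n → Set
  IncStep u v = Adj u v × u F.< v

  -- index-increasing path given by its (nonempty) vertex list;
  -- its length is (length of the list) - 1
  IsIncPath : List (Fin n) → Set
  IsIncPath ps = (1 ≤ length ps) × Linked IncStep ps

  IncPathsBounded : ℕ → Set
  IncPathsBounded k = ∀ ps → IsIncPath ps → length ps ≤ suc k

  Descendant : Fin n → Fin n → Set
  Descendant u v = Σ (List (Fin n)) λ xs → Linked IncStep (u ∷ xs ++ [ v ])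

  -- vertex set of the descendant graph of x^α
  InDescGraph : ∀ {k} → (Fin n → Fin k) → Fin n → Set
  InDescGraph α v = (0 < toℕ (α v)) ⊎ (∃ λ u → 0 < toℕ (α u) × Descendant u v)

  -- the induced subgraph on InDescGraph α is a forest:
  -- no cycle of G lies entirely inside that vertex set
  DescGraphIsForest : ∀ {k} → (Fin n → Fin k) → Set
  DescGraphIsForest α =
    ∀ c → IsCycle c → ¬ (∀ v → v ∈ c → InDescGraph α v)

-- |α| = Σ_w α_w, entries of Z_k identified with {0,…,k-1}
weight : ∀ {n k} → (Fin n → Fin k) → ℕ
weight {n} α = sum (map (λ w → toℕ (α w)) (allFin n))

{-# OPTIONS --safe #-}
-- Suppose a cycle C lies in the descendant graph; its length L is at least g. Along C,
-- index-increasing and index-decreasing runs have at most k edges, so every 2k consecutive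
-- steps contain a valley (a local minimum of the labelling). Hence C carries |α| + 1 valleys
-- within 2k·|α| positions of the first one. Each vertex of the descendant graph is reached
-- from some u ∈ supp α by an index-increasing path with at most k edges lying below it, and
-- |supp α| ≤ |α|, so two valleys a < b share such a root u. Between them C rises to a peak
-- above both, so the peak is met only once by the closed walk "peak, C forward to b, down to
-- u, up to a, C forward to the peak", which therefore contains a cycle of length at most
-- (b − a) + 2k ≤ 2k(|α| + 1) < g.
module Submission where

open import Defs
open import Level using (Level)
open import Data.Nat using (ℕ; zero; suc; _+_; _*_; _≤_; _<_; z≤n; s≤s; z<s; s≤s⁻¹; _<?_; _≤‴_; ≤‴-refl; ≤‴-step)
open import Data.Nat.Properties
open import Data.Nat.Tactic.RingSolver using (solve-∀)
open import Data.Fin using (Fin; toℕ; zero; suc)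
import Data.Fin as F
import Data.Fin.Properties as FP
open import Data.List using (List; []; _∷_; [_]; filter; lookup; allFin; applyUpTo; applyDownFrom; map)
import Data.List as List
open import Data.List.Properties using (length-applyUpTo; length-applyDownFrom; length-++)
open import Data.Nat.ListAction using (sum)
open import Data.List.Relation.Unary.Linked using (Linked; []; [-]; _∷_)
open import Data.List.Relation.Unary.All using ([]; _∷_)
import Data.List.Relation.Unary.All as All
open import Data.List.Relation.Unary.All.Properties using (¬Any⇒All¬)
open import Data.List.Relation.Unary.AllPairs using ([]; _∷_)
open import Data.List.Relation.Unary.Any using (here; there; index)
open import Data.List.Relation.Unary.Any.Properties using (lookup-index)
open import Data.List.Relation.Unary.Unique.Propositional using (Unique)
open import Data.List.Membership.Propositional using (_∈_; _∉_)
open import Data.List.Membership.Propositional.Properties using (∈-allFin; ∈-filter⁺)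
open import Data.List.Relation.Binary.Subset.Propositional using (_⊆_)
open import Data.Product using (Σ; ∃-syntax; ∃₂; _×_; _,_; proj₁; proj₂)
open import Data.Sum using (_⊎_; inj₁; inj₂)
import Data.Sum as Sum
open import Data.Empty using (⊥; ⊥-elim)
open import Function using (_∘_)
open import Relation.Nullary using (¬_; yes; no)
open import Relation.Unary using (Decidable)
open import Relation.Binary using (Rel; tri<; tri≈; tri>)
open import Relation.Binary.PropositionalEquality using (_≡_; _≢_; refl; sym; trans; cong; cong₂; subst; module ≡-Reasoning)

private
  variable
    ℓ : Level
    A : Set ℓ

-- The default d is returned for out-of-range indices.
nth : A → List A → ℕ → A
nth d []       _       = d
nth d (x ∷ xs) zero    = x
nth d (x ∷ xs) (suc i) = nth d xs i

nth-∈ : ∀ d (xs : List A) {i} → i < List.length xs → nth d xs i ∈ xs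
nth-∈ d (x ∷ xs) {zero}  _         = here refl
nth-∈ d (x ∷ xs) {suc i} (s≤s i<n) = there (nth-∈ d xs i<n)

nth-++ˡ : ∀ d (xs ys : List A) {i} → i < List.length xs → nth d (xs List.++ ys) i ≡ nth d xs i
nth-++ˡ d (x ∷ xs) ys {zero}  _         = refl
nth-++ˡ d (x ∷ xs) ys {suc i} (s≤s i<n) = nth-++ˡ d xs ys i<n

Linked⇒nth : ∀ {r} {R : Rel A r} d {xs} → Linked R xs →
             ∀ {i} → suc i < List.length xs → R (nth d xs i) (nth d xs (suc i))
Linked⇒nth d []      ()
Linked⇒nth d [-]     (s≤s ())
Linked⇒nth d (r ∷ _) {zero}  _         = r
Linked⇒nth d (_ ∷ l) {suc i} (s≤s i<n) = Linked⇒nth d l i<n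

nth-injective : ∀ d {xs : List A} → Unique xs → ∀ {i j} → i < List.length xs → j < List.length xs →
                nth d xs i ≡ nth d xs j → i ≡ j
nth-injective d {x ∷ xs} _       {zero}  {zero}  _         _         _  = refl
nth-injective d {x ∷ xs} (x∉ ∷ _) {zero}  {suc j} _         (s≤s j<n) eq = ⊥-elim (All.lookup x∉ (nth-∈ d xs j<n) eq)
nth-injective d {x ∷ xs} (x∉ ∷ _) {suc i} {zero}  (s≤s i<n) _         eq = ⊥-elim (All.lookup x∉ (nth-∈ d xs i<n) (sym eq))
nth-injective d {x ∷ xs} (_ ∷ u)  {suc i} {suc j} (s≤s i<n) (s≤s j<n) eq = cong suc (nth-injective d u i<n j<n eq)

linked-applyUpTo : ∀ {r} {R : Rel A r} (f : ℕ → A) n →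
                   (∀ {i} → suc i < n → R (f i) (f (suc i))) → Linked R (applyUpTo f n)
linked-applyUpTo f zero          _    = []
linked-applyUpTo f (suc zero)    _    = [-]
linked-applyUpTo f (suc (suc n)) step =
  step (s≤s (s≤s z≤n)) ∷ linked-applyUpTo (f ∘ suc) (suc n) (λ i<n → step (s≤s i<n))

linked-applyDownFrom : ∀ {r} {R : Rel A r} (f : ℕ → A) n →
                       (∀ {i} → suc i < n → R (f (suc i)) (f i)) → Linked R (applyDownFrom f n)
linked-applyDownFrom f zero          _    = []
linked-applyDownFrom f (suc zero)    _    = [-]
linked-applyDownFrom f (suc (suc n)) step =
  step ≤-refl ∷ linked-applyDownFrom f (suc n) (λ i<n → step (m<n⇒m<1+n i<n))

¬∀<⇒∃¬-smallest : ∀ {p} {P : ℕ → Set p} → Decidable P → ∀ m → ¬ (∀ {i} → i < m → P i) →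
                  ∃[ d ] d < m × (∀ {i} → i < d → P i) × ¬ P d
¬∀<⇒∃¬-smallest P? zero    ¬all = ⊥-elim (¬all λ ())
¬∀<⇒∃¬-smallest {P = P} P? (suc m) ¬all with P? 0
... | no ¬P0 = 0 , z<s , (λ ()) , ¬P0
... | yes P0 =
  let d , d<m , before , ¬Pd = ¬∀<⇒∃¬-smallest (λ i → P? (suc i)) m (λ all → ¬all (from-suc all))
  in suc d , s≤s d<m , from-suc before , ¬Pd
  where
    from-suc : ∀ {d} → (∀ {i} → i < d → P (suc i)) → ∀ {i} → i < suc d → P i
    from-suc _   {zero}  _         = P0
    from-suc all {suc i} (s≤s i<d) = all i<d

length-filter≤sum : ∀ {p} {P : A → Set p} (P? : Decidable P) (f : A → ℕ) → (∀ {x} → P x → 0 < f x) →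
                    (xs : List A) → List.length (filter P? xs) ≤ sum (map f xs)
length-filter≤sum P? f pos []       = z≤n
length-filter≤sum P? f pos (x ∷ xs) with P? x
... | yes Px = +-mono-≤ (pos Px) (length-filter≤sum P? f pos xs)
... | no _   = ≤-trans (length-filter≤sum P? f pos xs) (m≤n+m _ (f x))

pigeonhole-∈ : ∀ {m} (xs : List A) → List.length xs < m → (f : Fin m → A) → (∀ i → f i ∈ xs) →
               ∃₂ λ i j → i F.< j × f i ≡ f j
pigeonhole-∈ xs |xs|<m f f∈xs =
  let i , j , i<j , same = FP.pigeonhole |xs|<m (index ∘ f∈xs)
  in i , j , i<j , trans (lookup-index (f∈xs i)) (trans (cong (lookup xs) same) (sym (lookup-index (f∈xs j))))

module _ {P : ℕ → Set} {c L : ℕ} (next : ∀ p → c + p < L → ∃[ q ] p < q × q ≤ c + p × P q) where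

  spaced-family : ∀ w b → P b → w * c + b < L →
                  Σ (Fin (suc w) → ℕ) λ q → (∀ i → P (q i) × q i < L)
                                          × (∀ {i j} → i F.< j → q i < q j × q j ≤ w * c + q i)
  spaced-family w b Pb fits = q , (λ i → P-q i , ≤-<-trans (q-≤ i) (≤-<-trans (shift (FP.toℕ≤pred[n] i)) fits))
                                , (λ {i} {j} i<j → increasing i<j , spread i j)
    where
      shift : ∀ {i j} → i ≤ j → i * c + b ≤ j * c + b
      shift i≤j = +-monoˡ-≤ b (*-monoˡ-≤ c i≤j)

      room : (i : Fin w) → c + (toℕ i * c + b) < L
      room i = ≤-<-trans (≤-reflexive (sym (+-assoc c _ b))) (≤-<-trans (shift (FP.toℕ<n i)) fits)

      q : Fin (suc w) → ℕ
      q zero    = b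
      q (suc i) = proj₁ (next _ (room i))

      P-q : ∀ i → P (q i)
      P-q zero = Pb
      P-q (suc i) with next _ (room i)
      ... | _ , _ , _ , Pq = Pq

      q-> : (i : Fin w) → toℕ i * c + b < q (suc i)
      q-> i with next _ (room i)
      ... | _ , lt , _ = lt

      q-≤ : ∀ i → q i ≤ toℕ i * c + b
      q-≤ zero    = ≤-refl
      q-≤ (suc i) with next _ (room i)
      ... | _ , _ , q≤ , _ = ≤-trans q≤ (≤-reflexive (sym (+-assoc c _ b)))

      b≤q : ∀ i → b ≤ q i
      b≤q zero    = ≤-refl
      b≤q (suc i) = ≤-trans (m≤n+m b _) (<⇒≤ (q-> i))

      increasing : ∀ {i j} → i F.< j → q i < q j
      increasing {i} {suc j} (s≤s i≤j) = ≤-<-trans (≤-trans (q-≤ i) (shift i≤j)) (q-> j)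

      spread : ∀ i j → q j ≤ w * c + q i
      spread i j = ≤-trans (q-≤ j) (≤-trans (shift (FP.toℕ≤pred[n] j)) (+-monoʳ-≤ (w * c) (b≤q i)))

m*n+n≡n*[m+1] : ∀ m n → m * n + n ≡ n * (m + 1)
m*n+n≡n*[m+1] = solve-∀

m+[m+n]≡2*m+n : ∀ m n → m + (m + n) ≡ 2 * m + n
m+[m+n]≡2*m+n = solve-∀

+-cancel-gap : ∀ {g a b c d} → g + a ≤ b + c → b ≤ d + a → g ≤ d + c
+-cancel-gap {g} {a} {b} {c} {d} g+a≤b+c b≤d+a =
  +-cancelʳ-≤ a g (d + c) (≤-trans g+a≤b+c (≤-trans (+-monoˡ-≤ c b≤d+a) (≤-reflexive (swap d a c))))
  where
    swap : ∀ d a c → d + a + c ≡ d + c + a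
    swap = solve-∀

peak-between : ∀ {n} (f : ℕ → Fin n) {a b} → a ≤ b → f a F.< f (suc a) → f (suc b) F.< f b →
               ∃[ p ] a ≤ p × suc p ≤ b × f a F.< f (suc p) × f (suc b) F.< f (suc p)
peak-between f {a} a≤b rise fall with m≤n⇒m<n∨m≡n a≤b
... | inj₂ refl = ⊥-elim (<-asym rise fall)
... | inj₁ a<b@(s≤s {n = b′} a≤b′) with f (suc (suc b′)) FP.<? f (suc a)
...   | yes low = a , ≤-refl , a<b , rise , low
...   | no ¬low = b′ , a≤b′ , ≤-refl , <-trans (<-≤-trans rise (≮⇒≥ ¬low)) fall , fall

module Walks {n : ℕ} (G : SimpleGraph n) where
  open import Data.List.Membership.DecPropositional (FP._≟_ {n}) using (_∈?_)

  Adj-sym : ∀ {x y} → Adj G x y → Adj G y x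
  Adj-sym {x} {y} xy = trans (SimpleGraph.sym G y x) xy

  infixr 5 _∷_ _++_

  data Walk : Fin n → Fin n → Set where
    []  : ∀ {x} → Walk x x
    _∷_ : ∀ {x y z} → Adj G x y → Walk y z → Walk x z

  length : ∀ {x y} → Walk x y → ℕ
  length []      = 0
  length (_ ∷ W) = suc (length W)

  vertices : ∀ {x y} → Walk x y → List (Fin n)
  vertices {x} []      = [ x ]
  vertices {x} (_ ∷ W) = x ∷ vertices W

  start-∈ : ∀ {x y} (W : Walk x y) → x ∈ vertices W
  start-∈ []      = here refl
  start-∈ (_ ∷ _) = here refl

  length-vertices : ∀ {x y} (W : Walk x y) → List.length (vertices W) ≡ suc (length W)
  length-vertices []      = refl
  length-vertices (_ ∷ W) = cong suc (length-vertices W)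

  _++_ : ∀ {x y z} → Walk x y → Walk y z → Walk x z
  []      ++ V = V
  (e ∷ W) ++ V = e ∷ (W ++ V)

  length-++ʷ : ∀ {x y z} (W : Walk x y) (V : Walk y z) → length (W ++ V) ≡ length W + length V
  length-++ʷ []      V = refl
  length-++ʷ (_ ∷ W) V = cong suc (length-++ʷ W V)

  ∈-++⁻ : ∀ {x y z v} (W : Walk x y) (V : Walk y z) → v ∈ vertices (W ++ V) → v ∈ vertices W ⊎ v ∈ vertices V
  ∈-++⁻ []      V v∈         = inj₂ v∈
  ∈-++⁻ (_ ∷ W) V (here refl) = inj₁ (here refl)
  ∈-++⁻ (_ ∷ W) V (there v∈)  = Sum.map₁ there (∈-++⁻ W V v∈)

  reverse : ∀ {x y} → Walk x y → Walk y x
  reverse []      = []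
  reverse (e ∷ W) = reverse W ++ (Adj-sym e ∷ [])

  length-reverse : ∀ {x y} (W : Walk x y) → length (reverse W) ≡ length W
  length-reverse []      = refl
  length-reverse (e ∷ W) = trans (length-++ʷ (reverse W) _) (trans (+-comm _ 1) (cong suc (length-reverse W)))

  ∈-reverse⁻ : ∀ {x y v} (W : Walk x y) → v ∈ vertices (reverse W) → v ∈ vertices W
  ∈-reverse⁻ []      v∈ = v∈
  ∈-reverse⁻ (e ∷ W) v∈ with ∈-++⁻ (reverse W) (Adj-sym e ∷ []) v∈
  ... | inj₁ v∈W                 = there (∈-reverse⁻ W v∈W)
  ... | inj₂ (here refl)         = there (start-∈ W)
  ... | inj₂ (there (here refl)) = here refl

  suffix : ∀ {x y z} (W : Walk y z) → x ∈ vertices W →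
           Σ (Walk x z) λ V → vertices V ⊆ vertices W × length V ≤ length W
                            × (Unique (vertices W) → Unique (vertices V))
  suffix []      (here refl) = [] , (λ v∈ → v∈) , ≤-refl , (λ u → u)
  suffix (e ∷ W) (here refl) = e ∷ W , (λ v∈ → v∈) , ≤-refl , (λ u → u)
  suffix (_ ∷ W) (there x∈) =
    let V , V⊆W , V≤W , unique = suffix W x∈
    in V , (λ v∈ → there (V⊆W v∈)) , m≤n⇒m≤1+n V≤W , (λ { (_ ∷ u) → unique u })

  toPath : ∀ {x y} (W : Walk x y) →
           Σ (Walk x y) λ V → Unique (vertices V) × vertices V ⊆ vertices W × length V ≤ length W
  toPath []              = [] , [] ∷ [] , (λ v∈ → v∈) , z≤n
  toPath {x} (e ∷ W) with toPath W
  ... | V , uV , V⊆W , V≤W with x ∈? vertices V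
  ...   | yes x∈V = let S , S⊆V , S≤V , uS = suffix V x∈V
                    in S , uS uV , (λ v∈ → there (V⊆W (S⊆V v∈))) , m≤n⇒m≤1+n (≤-trans S≤V V≤W)
  ...   | no x∉V  = e ∷ V , ¬Any⇒All¬ _ x∉V ∷ uV
                  , (λ { (here refl) → here refl ; (there v∈) → there (V⊆W v∈) }) , s≤s V≤W

  closing-linked : ∀ {x y m} (W : Walk x y) → Adj G y m → Linked (Adj G) (vertices W List.++ [ m ])
  closing-linked []           ym = ym ∷ [-]
  closing-linked (e ∷ [])     ym = e ∷ ym ∷ [-]
  closing-linked (e ∷ f ∷ W)  ym = e ∷ closing-linked (f ∷ W) ym

  cycle-through : ∀ {x y m} (W : Walk x y) → Unique (vertices W) → x ≢ y → m ∉ vertices W →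
                  Adj G m x → Adj G y m →
                  IsCycle G (m ∷ vertices W) × List.length (m ∷ vertices W) ≡ 2 + length W
  cycle-through []      _  x≢x _   _  _  = ⊥-elim (x≢x refl)
  cycle-through (e ∷ W) uW _   m∉W mx ym =
    ( s≤s (s≤s (subst (1 ≤_) (sym (length-vertices W)) (s≤s z≤n)))
    , ¬Any⇒All¬ _ m∉W ∷ uW
    , mx ∷ closing-linked (e ∷ W) ym )
    , cong (2 +_) (length-vertices W)

  short-cycle : ∀ {x y m} (W : Walk x y) → x ≢ y → m ∉ vertices W → Adj G m x → Adj G y m →
                ∃[ c ] IsCycle G c × List.length c ≤ 2 + length W
  short-cycle W x≢y m∉W mx ym =
    let V , uV , V⊆W , V≤W = toPath W
        isCycle , len = cycle-through V uV x≢y (λ m∈V → m∉W (V⊆W m∈V)) mx ym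
    in _ , isCycle , ≤-trans (≤-reflexive len) (+-monoʳ-≤ 2 V≤W)

module Ancestry {n : ℕ} (G : SimpleGraph n) (k : ℕ) where
  open Walks G

  record Ancestor (u v : Fin n) : Set where
    field
      walk  : Walk u v
      below : ∀ {x} → x ∈ vertices walk → x F.≤ v
      short : length walk ≤ k

  increasing-walk : ∀ u xs v → Linked (IncStep G) (u ∷ xs List.++ [ v ]) →
                    Σ (Walk u v) λ W → (∀ {x} → x ∈ vertices W → x F.≤ v)
                                     × suc (length W) ≡ List.length (u ∷ xs List.++ [ v ])
  increasing-walk u []       v ((uv , u<v) ∷ [-]) =
    uv ∷ [] , (λ { (here refl) → <⇒≤ u<v ; (there (here refl)) → ≤-refl }) , refl
  increasing-walk u (y ∷ ys) v ((uy , u<y) ∷ rest) =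
    let W , below , len = increasing-walk y ys v rest
    in uy ∷ W , (λ { (here refl) → <⇒≤ (<-≤-trans u<y (below (start-∈ W))) ; (there x∈) → below x∈ })
              , cong suc len

  ancestor : IncPathsBounded G k → ∀ {m} {α : Fin n → Fin m} {v} → InDescGraph G α v →
             ∃[ u ] 0 < toℕ (α u) × Ancestor u v
  ancestor _ (inj₁ pos) =
    _ , pos , record { walk = [] ; below = λ { (here refl) → ≤-refl } ; short = z≤n }
  ancestor bounded (inj₂ (u , pos , xs , inc)) =
    let W , below , len = increasing-walk u xs _ inc
    in u , pos , record { walk = W ; below = below
                        ; short = s≤s⁻¹ (subst (_≤ suc k) (sym len) (bounded _ (s≤s z≤n , inc))) }

module OnCycle {n : ℕ} (G : SimpleGraph n) {v₀ : Fin n} {vs : List (Fin n)} (isCycle : IsCycle G (v₀ ∷ vs)) where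
  open Walks G

  L : ℕ
  L = List.length (v₀ ∷ vs)

  -- z i is the i-th vertex along the cycle for i < L, and z L = v₀ closes it up.
  z : ℕ → Fin n
  z = nth v₀ (v₀ ∷ vs List.++ [ v₀ ])

  z-adj : ∀ {i} → i < L → Adj G (z i) (z (suc i))
  z-adj i<L = Linked⇒nth v₀ (proj₂ (proj₂ isCycle))
                (s≤s (subst (suc _ ≤_) (sym (trans (length-++ vs) (+-comm _ 1))) i<L))

  z-on-cycle : ∀ {i} → i < L → z i ≡ nth v₀ (v₀ ∷ vs) i
  z-on-cycle = nth-++ˡ v₀ (v₀ ∷ vs) [ v₀ ]

  z-∈ : ∀ {i} → i < L → z i ∈ v₀ ∷ vs
  z-∈ i<L = subst (_∈ v₀ ∷ vs) (sym (z-on-cycle i<L)) (nth-∈ v₀ (v₀ ∷ vs) i<L)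

  z-injective : ∀ {i j} → i < L → j < L → z i ≡ z j → i ≡ j
  z-injective i<L j<L zi≡zj =
    nth-injective v₀ (proj₁ (proj₂ isCycle)) i<L j<L (trans (sym (z-on-cycle i<L)) (trans zi≡zj (z-on-cycle j<L)))

  up-or-down : ∀ {i} → i < L → z i F.< z (suc i) ⊎ z (suc i) F.< z i
  up-or-down {i} i<L with FP.<-cmp (z i) (z (suc i))
  ... | tri< up _ _   = inj₁ up
  ... | tri≈ _ same _ = ⊥-elim (SimpleGraph.irrefl G _ (subst (Adj G (z i)) (sym same) (z-adj i<L)))
  ... | tri> _ _ down = inj₂ down

  segment : ∀ {i j} → i ≤‴ j → j ≤ L → Walk (z i) (z j)
  segment ≤‴-refl         _   = []
  segment (≤‴-step i<j) j≤L = z-adj (<-≤-trans (≤‴⇒≤ i<j) j≤L) ∷ segment i<j j≤L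

  length-segment : ∀ {i j} (i≤j : i ≤‴ j) (j≤L : j ≤ L) → length (segment i≤j j≤L) + i ≡ j
  length-segment ≤‴-refl           _   = refl
  length-segment {i} (≤‴-step i<j) j≤L = trans (sym (+-suc _ i)) (length-segment i<j j≤L)

  ∈-segment⁻ : ∀ {i j v} (i≤j : i ≤‴ j) (j≤L : j ≤ L) → v ∈ vertices (segment i≤j j≤L) →
               ∃[ s ] i ≤ s × s ≤ j × v ≡ z s
  ∈-segment⁻ ≤‴-refl       _   (here refl) = _ , ≤-refl , ≤-refl , refl
  ∈-segment⁻ (≤‴-step i<j) _   (here refl) = _ , ≤-refl , <⇒≤ (≤‴⇒≤ i<j) , refl
  ∈-segment⁻ (≤‴-step i<j) j≤L (there v∈)  =
    let s , i<s , s≤j , v≡zs = ∈-segment⁻ i<j j≤L v∈ in s , <⇒≤ i<s , s≤j , v≡zs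

  z-∉-segment : ∀ {i j q} (i≤j : i ≤‴ j) (j<L : j < L) → q < L → q < i ⊎ j < q →
                z q ∉ vertices (segment i≤j (<⇒≤ j<L))
  z-∉-segment i≤j j<L q<L outside zq∈ with ∈-segment⁻ i≤j (<⇒≤ j<L) zq∈
  ... | s , i≤s , s≤j , zq≡zs with z-injective q<L (≤-<-trans s≤j j<L) zq≡zs
  ...   | refl = Sum.[ (λ q<i → <⇒≱ q<i i≤s) , (λ j<q → <⇒≱ j<q s≤j) ] outside

  Valley : ℕ → Set
  Valley zero    = ⊥
  Valley (suc q) = z (suc q) F.< z q × z (suc q) F.< z (suc (suc q))

  module _ {k : ℕ} (bounded : IncPathsBounded G k) where

    ascending-run-≤ : ∀ {p d} → d + p ≤ L → (∀ {i} → i < d → z (i + p) F.< z (suc i + p)) → d ≤ k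
    ascending-run-≤ {p} {d} d+p≤L up =
      s≤s⁻¹ (subst (_≤ suc k) (length-applyUpTo (λ i → z (i + p)) (suc d))
                   (bounded _ (s≤s z≤n , linked-applyUpTo (λ i → z (i + p)) (suc d) step)))
      where
        step : ∀ {i} → suc i < suc d → IncStep G (z (i + p)) (z (suc i + p))
        step (s≤s i<d) = z-adj (<-≤-trans (+-monoˡ-< p i<d) d+p≤L) , up i<d

    descending-run-≤ : ∀ {p d} → d + p ≤ L → (∀ {i} → i < d → z (suc i + p) F.< z (i + p)) → d ≤ k
    descending-run-≤ {p} {d} d+p≤L down =
      s≤s⁻¹ (subst (_≤ suc k) (length-applyDownFrom (λ i → z (i + p)) (suc d))
                   (bounded _ (s≤s z≤n , linked-applyDownFrom (λ i → z (i + p)) (suc d) step)))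
      where
        step : ∀ {i} → suc i < suc d → IncStep G (z (suc i + p)) (z (i + p))
        step (s≤s i<d) = Adj-sym (z-adj (<-≤-trans (+-monoˡ-< p i<d) d+p≤L)) , down i<d

    descent-within : ∀ p → k + p < L → ∃[ d ] d ≤ k × z (suc d + p) F.< z (d + p)
    descent-within p room
      with ¬∀<⇒∃¬-smallest (λ i → z (i + p) FP.<? z (suc i + p)) (suc k) (1+n≰n ∘ ascending-run-≤ room)
    ... | d , s≤s d≤k , _ , ¬up with up-or-down (≤-<-trans (+-monoˡ-≤ p d≤k) room)
    ...   | inj₁ up   = ⊥-elim (¬up up)
    ...   | inj₂ down = d , d≤k , down

    valley-after-descent : ∀ r → k + r < L → z (suc r) F.< z r → ∃[ e ] e < k × Valley (suc (e + r))
    valley-after-descent r room down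
      with ¬∀<⇒∃¬-smallest (λ i → z (suc i + r) FP.<? z (i + r)) (suc k) (1+n≰n ∘ descending-run-≤ room)
    ... | zero  , _ , _ , ¬down = ⊥-elim (¬down down)
    ... | suc e , s≤s e<k , downs , ¬down with up-or-down (≤-<-trans (+-monoˡ-≤ r e<k) room)
    ...   | inj₁ up    = e , e<k , downs ≤-refl , up
    ...   | inj₂ down′ = ⊥-elim (¬down down′)

    valley-after : ∀ p → 2 * k + p < L → ∃[ q ] p < q × q ≤ 2 * k + p × Valley q
    valley-after p room =
      let d , d≤k , down   = descent-within p (≤-<-trans (+-monoˡ-≤ p (m≤m+n k (k + 0))) room)
          e , e<k , valley = valley-after-descent (d + p) (≤-<-trans (within-2k ≤-refl d≤k) room) down
      in suc (e + (d + p)) , s≤s (≤-trans (m≤n+m p d) (m≤n+m (d + p) e)) , within-2k e<k d≤k , valley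
      where
        within-2k : ∀ {a b} → a ≤ k → b ≤ k → a + (b + p) ≤ 2 * k + p
        within-2k a≤k b≤k = ≤-trans (+-mono-≤ a≤k (+-monoˡ-≤ p b≤k)) (≤-reflexive (m+[m+n]≡2*m+n k p))

  module _ {u a p b} (a≤p : a ≤ p) (p+1<b : suc p < b) (b<L : b < L) (Wa : Walk u (z a)) (Wb : Walk u (z b)) where

    private
      p+1<L : suc p < L
      p+1<L = <-trans p+1<b b<L

      p<L : p < L
      p<L = <-trans (n<1+n p) p+1<L

      after : Walk (z (suc (suc p))) (z b)
      after = segment (≤⇒≤‴ p+1<b) (<⇒≤ b<L)

      before : Walk (z a) (z p)
      before = segment (≤⇒≤‴ a≤p) (<⇒≤ p<L)

    around-peak : Walk (z (suc (suc p))) (z p)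
    around-peak = after ++ reverse Wb ++ Wa ++ before

    length-around-peak : 2 + length around-peak + a ≡ b + (length Wa + length Wb)
    length-around-peak = begin
      2 + length around-peak + a              ≡⟨ cong (λ t → 2 + t + a) length-W ⟩
      2 + (ll + (lb + (la + lr))) + a         ≡⟨ rearrange ll lb la lr a ⟩
      ll + suc (suc (lr + a)) + (la + lb)     ≡⟨ cong (λ t → ll + suc (suc t) + (la + lb)) (length-segment (≤⇒≤‴ a≤p) _) ⟩
      ll + suc (suc p) + (la + lb)            ≡⟨ cong (_+ (la + lb)) (length-segment (≤⇒≤‴ p+1<b) _) ⟩
      b + (la + lb)                           ∎
      where
        open ≡-Reasoning
        ll = length after
        lb = length Wb
        la = length Wa
        lr = length before

        length-W : length around-peak ≡ ll + (lb + (la + lr))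
        length-W = trans (length-++ʷ after _)
                     (cong (ll +_) (trans (length-++ʷ (reverse Wb) _)
                       (cong₂ _+_ (length-reverse Wb) (length-++ʷ Wa before))))

        rearrange : ∀ ll lb la lr a → 2 + (ll + (lb + (la + lr))) + a ≡ ll + suc (suc (lr + a)) + (la + lb)
        rearrange = solve-∀

    peak-∉-around-peak : (∀ {x} → x ∈ vertices Wa → x F.< z (suc p)) → (∀ {x} → x ∈ vertices Wb → x F.< z (suc p)) →
                         z (suc p) ∉ vertices around-peak
    peak-∉-around-peak Wa<peak Wb<peak peak∈ with ∈-++⁻ after _ peak∈
    ... | inj₁ ∈after = z-∉-segment (≤⇒≤‴ p+1<b) b<L p+1<L (inj₁ (n<1+n (suc p))) ∈after
    ... | inj₂ ∈rest with ∈-++⁻ (reverse Wb) _ ∈rest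
    ...   | inj₁ ∈Wb = <-irrefl refl (Wb<peak (∈-reverse⁻ Wb ∈Wb))
    ...   | inj₂ ∈rest′ with ∈-++⁻ Wa before ∈rest′
    ...     | inj₁ ∈Wa     = <-irrefl refl (Wa<peak ∈Wa)
    ...     | inj₂ ∈before = z-∉-segment (≤⇒≤‴ a≤p) p<L p+1<L (inj₂ (n<1+n p)) ∈before

    girth-around-peak : ∀ {g} → (∀ c → IsCycle G c → g ≤ List.length c) →
                        (∀ {x} → x ∈ vertices Wa → x F.< z (suc p)) → (∀ {x} → x ∈ vertices Wb → x F.< z (suc p)) →
                        g + a ≤ b + (length Wa + length Wb)
    girth-around-peak girth-≤ Wa<peak Wb<peak =
      let c , isCycle , c≤ = short-cycle around-peak ends-differ (peak-∉-around-peak Wa<peak Wb<peak)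
                                         (z-adj p+1<L) (z-adj p<L)
      in ≤-trans (+-monoˡ-≤ a (≤-trans (girth-≤ c isCycle) c≤)) (≤-reflexive length-around-peak)
      where
        ends-differ : z (suc (suc p)) ≢ z p
        ends-differ same with z-injective (≤-<-trans p+1<b b<L) p<L same
        ... | ()

  module _ {k g m : ℕ} (bounded : IncPathsBounded G k) (girth-≤ : ∀ c → IsCycle G c → g ≤ List.length c)
           (α : Fin n → Fin m) (inside : ∀ v → v ∈ v₀ ∷ vs → InDescGraph G α v) where
    open Ancestry G k
    open Ancestor

    common-ancestor-gap : ∀ {u a b} → Valley a → Valley b → a < b → b < L →
                          Ancestor u (z a) → Ancestor u (z b) → g + a ≤ b + 2 * k
    common-ancestor-gap {a = suc _} {b = suc b′} (_ , rise) (fall , _) (s≤s a≤b′) b<L Aa Ab =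
      let p , a≤p , p+1≤b′ , za<peak , zb<peak = peak-between z a≤b′ rise fall
      in ≤-trans (girth-around-peak a≤p (s≤s p+1≤b′) b<L (walk Aa) (walk Ab) girth-≤
                   (λ x∈ → ≤-<-trans (below Aa x∈) za<peak) (λ x∈ → ≤-<-trans (below Ab x∈) zb<peak))
                 (+-monoʳ-≤ (suc b′) (+-mono-≤ (short Aa) (m≤n⇒m≤n+o 0 (short Ab))))

    ancestor-at : ∀ {q} → q < L → ∃[ u ] 0 < toℕ (α u) × Ancestor u (z q)
    ancestor-at q<L = ancestor bounded (inside _ (z-∈ q<L))

    support : List (Fin n)
    support = filter (λ u → 0 <? toℕ (α u)) (allFin n)

    shared-ancestor : (q : Fin (suc (weight α)) → ℕ) → (∀ i → q i < L) →
                      ∃₂ λ i j → i F.< j × ∃[ u ] Ancestor u (z (q i)) × Ancestor u (z (q j))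
    shared-ancestor q q<L =
      let i , j , i<j , same = pigeonhole-∈ support |support|<w+1 (proj₁ ∘ ancestor-at ∘ q<L)
                                 (λ i → ∈-filter⁺ _ (∈-allFin _) (proj₁ (proj₂ (ancestor-at (q<L i)))))
      in i , j , i<j , _ , proj₂ (proj₂ (ancestor-at (q<L i)))
                         , subst (λ u → Ancestor u (z (q j))) (sym same) (proj₂ (proj₂ (ancestor-at (q<L j))))
      where
        |support|<w+1 : List.length support < suc (weight α)
        |support|<w+1 = s≤s (length-filter≤sum _ (toℕ ∘ α) (λ pos → pos) (allFin n))

    cycle-long : 2 * k * (weight α + 1) < g → weight α * (2 * k) + 2 * k < L
    cycle-long fits = <-≤-trans (subst (_< g) (sym (m*n+n≡n*[m+1] (weight α) (2 * k))) fits) (girth-≤ _ isCycle)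

    no-cycle : 2 * k * (weight α + 1) < g → ⊥
    no-cycle fits =
      let b₀ , _ , b₀≤2k , valley-b₀ = valley-after bounded 0 first-window
          q , valley-q , spaced = spaced-family (valley-after bounded) (weight α) b₀ valley-b₀ (family-room b₀≤2k)
          i , j , i<j , _ , Ai , Aj = shared-ancestor q (λ i → proj₂ (valley-q i))
          qi<qj , qj≤ = spaced i<j
          gap = common-ancestor-gap (proj₁ (valley-q i)) (proj₁ (valley-q j)) qi<qj (proj₂ (valley-q j)) Ai Aj
      in <⇒≱ fits (≤-trans (+-cancel-gap gap qj≤) (≤-reflexive (m*n+n≡n*[m+1] (weight α) (2 * k))))
      where
        family-room : ∀ {b} → b ≤ 2 * k + 0 → weight α * (2 * k) + b < L
        family-room b≤ = ≤-<-trans (+-monoʳ-≤ _ (≤-trans b≤ (≤-reflexive (+-identityʳ (2 * k))))) (cycle-long fits)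
        first-window : 2 * k + 0 < L
        first-window = ≤-<-trans (m≤n+m (2 * k + 0) (weight α * (2 * k))) (family-room ≤-refl)

lemma4p2 : (k : ℕ) → 3 ≤ k → (n : ℕ) → (G : SimpleGraph n) → (g : ℕ)
    → ChromaticNumberSuc G k
    → Girth G g
    → 2 * k < g
    → IncPathsBounded G k
    → (α : Fin n → Fin k)
    → 2 * k * (weight α + 1) < g
    → DescGraphIsForest G α
lemma4p2 k _ n G g _ (_ , girth-≤) _ bounded α fits [] ()
lemma4p2 k _ n G g _ (_ , girth-≤) _ bounded α fits (v₀ ∷ vs) isCycle inside =
  OnCycle.no-cycle G isCycle bounded girth-≤ α inside fits
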